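{- Let $M$ be a $\lambda_\oplus$-term. Then $L(\mathcal T(M))=\mathcal T(L(M))$.
   Context: $\lambda_\oplus$-terms: $M,N,P,Q ::= x\mid\lambda x.M\mid MN\mid M\oplus N$ up to renaming of bound variables; $M[N/x]$ is capture-avoiding substitution; application associates to the left; $\lambda\vec x$ is a possibly empty sequence of abstractions. The function $L$ on $\lambda_\oplus$-terms: $L(M\oplus N)=L(M)\oplus L(N)$; $L(\lambda\vec x.\lambda y.(M\oplus N))=\lambda\vec x.(\lambda y.M\oplus\lambda y.N)$; $L(\lambda\vec x.(M\oplus N)PQ_1\cdots Q_k)=\lambda\vec x.(MP\oplus NP)Q_1\cdots Q_k$; $L(\lambda\vec x.yQ_1\cdots Q_k)=\lambda\vec x.y\,L(Q_1)\cdots L(Q_k)$; $L(\lambda\vec x.(\lambda y.M)NQ_1\cdots Q_k)=\lambda\vec x.M[N/y]Q_1\cdots Q_k$ ($k\ge0$). Resource terms and monomials: $s,t ::= x\mid\lambda x.s\mid\langle s\rangle\bar t\mid s\oplus\bullet\mid\bullet\oplus s$, $\bar t::=[t_1,\dots,t_n]$ (finite multisets); $\langle s\rangle\bar t_1\cdots\bar t_k$ abbreviates iterated application. Finite formal sums with coefficients in $\mathbb N$, with supports $\mathrm{supp}$; constructors extended by multilinearity. For $\bar u=[u_1,\dots,u_n]$, $\partial_xe\cdot\bar u$: $\partial_xy\cdot\bar u$ is $y$ if $y\ne x$ and $n=0$, $u_1$ if $y=x$ and $n=1$, $0$ otherwise; it commutes with $\lambda y.$ ($y$ fresh), $-\oplus\bullet$,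 $\bullet\oplus-$; $\partial_x(\langle s\rangle\bar t)\cdot\bar u=\sum_{(I_1,I_2)}\langle\partial_xs\cdot\bar u_{I_1}\rangle(\partial_x\bar t\cdot\bar u_{I_2})$; $\partial_x[t_1,\dots,t_k]\cdot\bar u=\sum_{(I_1,\dots,I_k)}[\partial_xt_1\cdot\bar u_{I_1},\dots,\partial_xt_k\cdot\bar u_{I_k}]$, sums over tuples of pairwise disjoint possibly empty subsets of $\{1,\dots,n\}$ covering it, $\bar u_I=[u_i\mid i\in I]$. The hereditary head reduction $L$ on resource expressions: $L(s\oplus\bullet)=L(s)\oplus\bullet$; $L(\bullet\oplus s)=\bullet\oplus L(s)$; $L(\lambda\vec x.\lambda y.(s\oplus\bullet))=\lambda\vec x.((\lambda y.s)\oplus\bullet)$; $L(\lambda\vec x.\lambda y.(\bullet\oplus s))=\lambda\vec x.(\bullet\oplus\lambda y.s)$; $L(\lambda\vec x.\langle\langle s\oplus\bullet\rangle\bar t\rangle\bar u_1\cdots\bar u_k)=\lambda\vec x.\langle(\langle s\rangle\bar t)\oplus\bullet\rangle\bar u_1\cdots\bar u_k$; $L(\lambda\vec x.\langle\langle\bullet\oplus s\rangle\bar t\rangle\bar u_1\cdots\bar u_k)=\lambda\vec x.\langle\bullet\oplus\langle s\rangle\bar t\rangle\bar u_1\cdots\bar u_k$; $L(\lambda\vec x.\langle y\rangle\bar s_1\cdots\bar s_k)=\lambda\vec x.\langle y\rangle L(\bar s_1)\cdots L(\bar s_k)$; $L([s_1,\dots,s_k])=[L(s_1),\dots,L(s_k)]$;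 $L(\lambda\vec x.\langle\lambda y.s\rangle\bar t\,\bar u_1\cdots\bar u_k)=\lambda\vec x.\langle\partial_ys\cdot\bar t\rangle\bar u_1\cdots\bar u_k$; extended by linearity. For a set $E$ of resource expressions, $L(E)=\bigcup_{e\in E}\mathrm{supp}(L(e))$. The Taylor support: $\mathcal T(x)=\{x\}$, $\mathcal T(\lambda x.N)=\{\lambda x.t\mid t\in\mathcal T(N)\}$, $\mathcal T(PQ)=\{\langle s\rangle[t_1,\dots,t_n]\mid n\ge0,\ s\in\mathcal T(P),\ t_i\in\mathcal T(Q)\}$, $\mathcal T(P\oplus Q)=\{s\oplus\bullet\mid s\in\mathcal T(P)\}\cup\{\bullet\oplus t\mid t\in\mathcal T(Q)\}$. -}

module Defs where

open import Data.Nat using (ℕ; zero; suc)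
open import Data.Fin using (Fin; zero; suc; punchOut)
open import Data.Fin.Properties using (_≟_)
open import Data.Bool using (Bool; true; false; if_then_else_)
open import Data.List using (List; []; _∷_; [_]; map; concatMap)
open import Data.List.Relation.Unary.All using (All)
open import Data.List.Relation.Binary.Permutation.Homogeneous using (Permutation)
open import Data.List.Membership.Propositional using (_∈_)
open import Data.Product using (_×_; _,_; ∃)
open import Relation.Nullary using (yes; no)

-- λ⊕-terms, scoped de Bruijn representation (terms up to α-renaming).
-- Tm n : terms with free variables among n de Bruijn indices.

data Tm (n : ℕ) : Set where
  var  : Fin n → Tm n
  lam  : Tm (suc n) → Tm n
  app  : Tm n → Tm n → Tm n
  _⊕_  : Tm n → Tm n → Tm n

ext : ∀ {n m} → (Fin n → Fin m) → Fin (suc n) → Fin (suc m)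
ext ρ zero    = zero
ext ρ (suc i) = suc (ρ i)

rename : ∀ {n m} → (Fin n → Fin m) → Tm n → Tm m
rename ρ (var i)   = var (ρ i)
rename ρ (lam M)   = lam (rename (ext ρ) M)
rename ρ (app M N) = app (rename ρ M) (rename ρ N)
rename ρ (M ⊕ N)   = rename ρ M ⊕ rename ρ N

exts : ∀ {n m} → (Fin n → Tm m) → Fin (suc n) → Tm (suc m)
exts σ zero    = var zero
exts σ (suc i) = rename suc (σ i)

subst : ∀ {n m} → (Fin n → Tm m) → Tm n → Tm m
subst σ (var i)   = σ i
subst σ (lam M)   = lam (subst (exts σ) M)
subst σ (app M N) = app (subst σ M) (subst σ N)
subst σ (M ⊕ N)   = subst σ M ⊕ subst σ N

-- M [ N ]₀ is M[N/y] where y is the variable bound by the λ around M.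
single : ∀ {n} → Tm n → Fin (suc n) → Tm n
single N zero    = N
single N (suc i) = var i

_[_]₀ : ∀ {n} → Tm (suc n) → Tm n → Tm n
M [ N ]₀ = subst (single N) M

-- L (M ⊕ N)          = L M ⊕ L N
-- L (λ y. (M ⊕ N))   = λy.M ⊕ λy.N        (the case λx⃗.λy.(M⊕N))
-- L (λ y. M)         = λ y. L M  otherwise (the λx⃗ prefix is kept)
-- L (M N)            by the head of the application spine (Lapp):
--   y Q₁⋯Qₖ          ↦ y L(Q₁)⋯L(Qₖ)
--   (λy.M) N Q₁⋯Qₖ   ↦ M[N/y] Q₁⋯Qₖ
--   (M⊕N) P Q₁⋯Qₖ    ↦ (MP ⊕ NP) Q₁⋯Qₖ

varHeadTm : ∀ {n} → Tm n → Bool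
varHeadTm (var _)   = true
varHeadTm (app M _) = varHeadTm M
varHeadTm (lam _)   = false
varHeadTm (_ ⊕ _)   = false

mutual
  Lt : ∀ {n} → Tm n → Tm n
  Lt (var x)       = var x
  Lt (lam (M ⊕ N)) = lam M ⊕ lam N
  Lt (lam (var x))   = lam (Lt (var x))
  Lt (lam (lam M))   = lam (Lt (lam M))
  Lt (lam (app M N)) = lam (Lt (app M N))
  Lt (app M N)     = Ltapp M N
  Lt (M ⊕ N)       = Lt M ⊕ Lt N

  Ltapp : ∀ {n} → Tm n → Tm n → Tm n
  Ltapp (var x)   N = app (var x) (Lt N)
  Ltapp (lam M)   N = M [ N ]₀
  Ltapp (M₁ ⊕ M₂) N = app M₁ N ⊕ app M₂ N
  Ltapp (app M P) N =
    if varHeadTm M then app (Ltapp M P) (Lt N) else app (Ltapp M P) N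

-- Resource terms (scoped de Bruijn) and bags (finite multisets,
-- represented by lists; multiset equality is the relation _≈ᵇ_ below).

data Res (n : ℕ) : Set where
  var  : Fin n → Res n
  lam  : Res (suc n) → Res n
  app  : Res n → List (Res n) → Res n
  _⊕• : Res n → Res n
  •⊕_ : Res n → Res n

Bag : ℕ → Set
Bag n = List (Res n)

-- Finite formal sums with coefficients in ℕ are represented as lists
-- (an element repeated k times has coefficient k); the support of a sum
-- is then list membership.
Sum : Set → Set
Sum A = List A

supp : ∀ {A : Set} → Sum A → A → Set
supp σ a = a ∈ σ

-- Equality of resource expressions: bags are multisets, so equality is
-- up to permutation of (equal) bag elements, hereditarily.
mutual
  data _≈_ {n : ℕ} : Res n → Res n → Set where
    var : ∀ {x} → var x ≈ var x
    lam : ∀ {s t} → s ≈ t → lam s ≈ lam t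
    app : ∀ {s t b c} → s ≈ t → b ≈ᵇ c → app s b ≈ app t c
    l⊕  : ∀ {s t} → s ≈ t → (s ⊕•) ≈ (t ⊕•)
    r⊕  : ∀ {s t} → s ≈ t → (•⊕ s) ≈ (•⊕ t)

  data _≈ᵇ_ {n : ℕ} : Bag n → Bag n → Set where
    bag : ∀ {b c} → Permutation _≈_ b c → b ≈ᵇ c

mutual
  renameR : ∀ {n m} → (Fin n → Fin m) → Res n → Res m
  renameR ρ (var i)   = var (ρ i)
  renameR ρ (lam s)   = lam (renameR (ext ρ) s)
  renameR ρ (app s b) = app (renameR ρ s) (renameB ρ b)
  renameR ρ (s ⊕•)    = renameR ρ s ⊕•
  renameR ρ (•⊕ s)    = •⊕ renameR ρ s

  renameB : ∀ {n m} → (Fin n → Fin m) → Bag n → Bag m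
  renameB ρ []      = []
  renameB ρ (s ∷ b) = renameR ρ s ∷ renameB ρ b

-- all ways of splitting a list ū into (ū_{I₁}, ū_{I₂}) with (I₁,I₂)
-- ranging over pairs of disjoint subsets covering the index set
splits : ∀ {A : Set} → List A → List (List A × List A)
splits []      = ([] , []) ∷ []
splits (u ∷ us) =
  concatMap (λ { (l , r) → (u ∷ l , r) ∷ (l , u ∷ r) ∷ [] }) (splits us)

-- Linear substitution ∂ₓ e · ū, where x is the variable i of the scope
-- (it is removed from the scope in the result).
mutual
  ∂ : ∀ {n} → Fin (suc n) → Res (suc n) → Bag n → Sum (Res n)
  ∂ i (var j) ū with i ≟ j
  ∂ i (var j) (u ∷ []) | yes _ = u ∷ []
  ∂ i (var j) _        | yes _ = []
  ∂ i (var j) []       | no i≢j = var (punchOut i≢j) ∷ []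
  ∂ i (var j) (_ ∷ _)  | no _   = []
  ∂ i (lam s) ū = map lam (∂ (suc i) s (renameB suc ū))
  ∂ i (app s t) ū =
    concatMap (λ { (ū₁ , ū₂) →
      concatMap (λ a → map (app a) (∂ᵇ i t ū₂)) (∂ i s ū₁) }) (splits ū)
  ∂ i (s ⊕•) ū = map _⊕• (∂ i s ū)
  ∂ i (•⊕ s) ū = map •⊕_ (∂ i s ū)

  ∂ᵇ : ∀ {n} → Fin (suc n) → Bag (suc n) → Bag n → Sum (Bag n)
  ∂ᵇ i [] []      = [] ∷ []
  ∂ᵇ i [] (_ ∷ _) = []
  ∂ᵇ i (t ∷ ts) ū =
    concatMap (λ { (ū₁ , ū₂) →
      concatMap (λ a → map (a ∷_) (∂ᵇ i ts ū₂)) (∂ i t ū₁) }) (splits ū)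

varHeadR : ∀ {n} → Res n → Bool
varHeadR (var _)   = true
varHeadR (app s _) = varHeadR s
varHeadR (lam _)   = false
varHeadR (_ ⊕•)    = false
varHeadR (•⊕ _)    = false

mutual
  Lr : ∀ {n} → Res n → Sum (Res n)
  Lr (var x)          = var x ∷ []
  Lr (lam (s ⊕•))     = (lam s ⊕•) ∷ []
  Lr (lam (•⊕ s))     = (•⊕ lam s) ∷ []
  Lr (lam (var x))    = map lam (Lr (var x))
  Lr (lam (lam s))    = map lam (Lr (lam s))
  Lr (lam (app s t))  = map lam (Lr (app s t))
  Lr (app s t)        = Lrapp s t
  Lr (s ⊕•)           = map _⊕• (Lr s)
  Lr (•⊕ s)           = map •⊕_ (Lr s)

  Lrapp : ∀ {n} → Res n → Bag n → Sum (Res n)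
  Lrapp (var x) t = map (app (var x)) (Lb t)
  Lrapp (lam s) t = ∂ zero s t
  Lrapp (s ⊕•)  t = (app s t ⊕•) ∷ []
  Lrapp (•⊕ s)  t = (•⊕ app s t) ∷ []
  Lrapp (app s u) t =
    if varHeadR s
    then concatMap (λ r → map (app r) (Lb t)) (Lrapp s u)
    else map (λ r → app r t) (Lrapp s u)

  Lb : ∀ {n} → Bag n → Sum (Bag n)
  Lb []      = [] ∷ []
  Lb (s ∷ b) = concatMap (λ r → map (r ∷_) (Lb b)) (Lr s)

RSet : ℕ → Set₁
RSet n = Res n → Set

LSet : ∀ {n} → RSet n → RSet n
LSet E u = ∃ λ e → E e × supp (Lr e) u

data 𝒯 {n : ℕ} : Tm n → RSet n where
  var : ∀ {x} → 𝒯 (var x) (var x)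
  lam : ∀ {N t} → 𝒯 N t → 𝒯 (lam N) (lam t)
  app : ∀ {P Q s ts} → 𝒯 P s → All (𝒯 Q) ts → 𝒯 (app P Q) (app s ts)
  l⊕  : ∀ {P Q s} → 𝒯 P s → 𝒯 (P ⊕ Q) (s ⊕•)
  r⊕  : ∀ {P Q t} → 𝒯 Q t → 𝒯 (P ⊕ Q) (•⊕ t)

_≡ₛ_ : ∀ {n} → RSet n → RSet n → Set
E ≡ₛ F = ∀ u → ((∃ λ u' → u ≈ u' × E u') → ∃ λ u' → u ≈ u' × F u')
             × ((∃ λ u' → u ≈ u' × F u') → ∃ λ u' → u ≈ u' × E u')

module Submission where

-- L (𝒯 M) = 𝒯 (L M) is proved as two inclusions, each by induction on M
-- following the clauses that define L on terms (Lt, Ltapp) and on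
-- resource expressions (Lr, Lrapp, Lb): every clause of the term-level
-- L is matched by the same clause of the resource-level L acting on the
-- approximants of M.  Two facts carry the non-trivial cases.
--   * Taylor expansion commutes with substitution: the approximants of
--     M[N/x] are exactly the elements of the linear substitutions
--     ∂ₓ s · ū with s ∈ 𝒯 M and ū a bag of approximants of N.  This is
--     the β-clause; under binders it needs that 𝒯 commutes with renaming.
--   * An approximant has a variable in head position iff the term does,
--     so the case distinctions made by Ltapp and Lrapp agree.

open import Defs
open import Data.Nat using (ℕ; suc)
open import Data.Bool using (true; false)
open import Data.Fin using (Fin; zero; suc; punchOut)
open import Data.Fin.Properties using (_≟_; punchOut-cong)
open import Data.List using (List; []; _∷_; map; concatMap; _++_)
open import Data.List.Relation.Unary.All using (All; []; _∷_)
open import Data.List.Relation.Unary.All.Properties using (++⁺)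
open import Data.List.Relation.Unary.Any using (here; there)
open import Data.List.Membership.Propositional using (_∈_; find; lose)
open import Data.List.Membership.Propositional.Properties
  using (∈-map⁺; ∈-map⁻; ∈-concatMap⁺; ∈-concatMap⁻)
open import Data.Product using (Σ; ∃; ∃₂; _×_; _,_)
open import Data.Sum using (_⊎_; inj₁; inj₂)
open import Data.Empty using (⊥-elim)
open import Relation.Nullary using (yes; no)
open import Relation.Unary using (_⊆_)
open import Relation.Binary.PropositionalEquality using (_≡_; _≢_; refl; trans; cong)

∈-concatMap⁺′ : ∀ {A B : Set} (f : A → List B) {xs x y} →
                x ∈ xs → y ∈ f x → y ∈ concatMap f xs
∈-concatMap⁺′ f x∈xs y∈fx = ∈-concatMap⁺ f (lose x∈xs y∈fx)

∈-concatMap⁻′ : ∀ {A B : Set} (f : A → List B) {xs y} →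
                y ∈ concatMap f xs → ∃ λ x → x ∈ xs × y ∈ f x
∈-concatMap⁻′ f y∈ = find (∈-concatMap⁻ f y∈)

∈-product⁺ : ∀ {A B C : Set} (g : A → B → C) {xs ys a b} →
             a ∈ xs → b ∈ ys → g a b ∈ concatMap (λ a → map (g a) ys) xs
∈-product⁺ g a∈xs b∈ys = ∈-concatMap⁺′ _ a∈xs (∈-map⁺ (g _) b∈ys)

∈-product⁻ : ∀ {A B C : Set} (g : A → B → C) {xs ys v} →
             v ∈ concatMap (λ a → map (g a) ys) xs →
             ∃₂ λ a b → a ∈ xs × b ∈ ys × v ≡ g a b
∈-product⁻ g v∈ =
  let a , a∈xs , v∈map = ∈-concatMap⁻′ _ v∈
      b , b∈ys , v≡gab = ∈-map⁻ (g a) v∈map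
  in  a , b , a∈xs , b∈ys , v≡gab

splits-++ : ∀ {A : Set} (ū₁ ū₂ : List A) → (ū₁ , ū₂) ∈ splits (ū₁ ++ ū₂)
splits-++ []       []       = here refl
splits-++ []       (u ∷ ū₂) = ∈-concatMap⁺′ _ (splits-++ [] ū₂) (there (here refl))
splits-++ (u ∷ ū₁) ū₂       = ∈-concatMap⁺′ _ (splits-++ ū₁ ū₂) (here refl)

splits-All : ∀ {A : Set} {P : A → Set} (ū : List A) {ū₁ ū₂} →
             (ū₁ , ū₂) ∈ splits ū → All P ū → All P ū₁ × All P ū₂
splits-All []      (here refl) [] = [] , []
splits-All (u ∷ ū) ∈splits (pu ∷ pū)
  with ∈-concatMap⁻′ (λ { (l , r) → (u ∷ l , r) ∷ (l , u ∷ r) ∷ [] }) {splits ū} ∈splits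
... | (_ , _) , ∈splits′ , here refl =
  let p₁ , p₂ = splits-All ū ∈splits′ pū in pu ∷ p₁ , p₂
... | (_ , _) , ∈splits′ , there (here refl) =
  let p₁ , p₂ = splits-All ū ∈splits′ pū in p₁ , pu ∷ p₂

∂-var-here : ∀ {n} (i : Fin (suc n)) (u : Res n) → u ∈ ∂ i (var i) (u ∷ [])
∂-var-here i u with i ≟ i
... | yes _   = here refl
... | no i≢i = ⊥-elim (i≢i refl)

∂-var-other : ∀ {n} {i j : Fin (suc n)} (i≢j : i ≢ j) →
              var (punchOut i≢j) ∈ ∂ i (var j) []
∂-var-other {i = i} {j} i≢j with i ≟ j
... | yes i≡j = ⊥-elim (i≢j i≡j)
... | no _    = here (cong var (punchOut-cong i refl))

∂-var⁻ : ∀ {n} (i j : Fin (suc n)) (ū : Bag n) {u} → u ∈ ∂ i (var j) ū →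
         (i ≡ j × ū ≡ u ∷ []) ⊎ Σ (i ≢ j) λ i≢j → ū ≡ [] × u ≡ var (punchOut i≢j)
∂-var⁻ i j ū u∈ with i ≟ j
∂-var⁻ i j (u ∷ [])    (here refl) | yes i≡j = inj₁ (i≡j , refl)
∂-var⁻ i j []          ()          | yes _
∂-var⁻ i j (_ ∷ _ ∷ _) ()          | yes _
∂-var⁻ i j []          (here refl) | no i≢j  = inj₂ (i≢j , refl , refl)
∂-var⁻ i j (_ ∷ _)     ()          | no _

∂-app⁺ : ∀ {n} (i : Fin (suc n)) s t (ū₁ ū₂ : Bag n) {a b} →
         a ∈ ∂ i s ū₁ → b ∈ ∂ᵇ i t ū₂ → app a b ∈ ∂ i (app s t) (ū₁ ++ ū₂)
∂-app⁺ i s t ū₁ ū₂ a∈ b∈ = ∈-concatMap⁺′ _ (splits-++ ū₁ ū₂) (∈-product⁺ app a∈ b∈)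

∂-app⁻ : ∀ {n} (i : Fin (suc n)) s t (ū : Bag n) {u} → u ∈ ∂ i (app s t) ū →
         ∃₂ λ ū₁ ū₂ → (ū₁ , ū₂) ∈ splits ū ×
           ∃₂ λ a b → a ∈ ∂ i s ū₁ × b ∈ ∂ᵇ i t ū₂ × u ≡ app a b
∂-app⁻ i s t ū u∈ =
  let (ū₁ , ū₂) , ∈splits , u∈′ = ∈-concatMap⁻′ _ {splits ū} u∈
  in  ū₁ , ū₂ , ∈splits , ∈-product⁻ app u∈′

∂ᵇ-cons⁺ : ∀ {n} (i : Fin (suc n)) t ts (ū₁ ū₂ : Bag n) {a b} →
           a ∈ ∂ i t ū₁ → b ∈ ∂ᵇ i ts ū₂ → a ∷ b ∈ ∂ᵇ i (t ∷ ts) (ū₁ ++ ū₂)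
∂ᵇ-cons⁺ i t ts ū₁ ū₂ a∈ b∈ = ∈-concatMap⁺′ _ (splits-++ ū₁ ū₂) (∈-product⁺ _∷_ a∈ b∈)

∂ᵇ-cons⁻ : ∀ {n} (i : Fin (suc n)) t ts (ū : Bag n) {v} → v ∈ ∂ᵇ i (t ∷ ts) ū →
           ∃₂ λ ū₁ ū₂ → (ū₁ , ū₂) ∈ splits ū ×
             ∃₂ λ a b → a ∈ ∂ i t ū₁ × b ∈ ∂ᵇ i ts ū₂ × v ≡ a ∷ b
∂ᵇ-cons⁻ i t ts ū v∈ =
  let (ū₁ , ū₂) , ∈splits , v∈′ = ∈-concatMap⁻′ _ {splits ū} v∈
  in  ū₁ , ū₂ , ∈splits , ∈-product⁻ _∷_ v∈′

mutual
  𝒯-rename⁺ : ∀ {n m} (ρ : Fin n → Fin m) {M s} →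
              𝒯 M s → 𝒯 (rename ρ M) (renameR ρ s)
  𝒯-rename⁺ ρ var          = var
  𝒯-rename⁺ ρ (lam ts)     = lam (𝒯-rename⁺ (ext ρ) ts)
  𝒯-rename⁺ ρ (app ts tū)  = app (𝒯-rename⁺ ρ ts) (𝒯-renameᵇ⁺ ρ tū)
  𝒯-rename⁺ ρ (l⊕ ts)      = l⊕ (𝒯-rename⁺ ρ ts)
  𝒯-rename⁺ ρ (r⊕ ts)      = r⊕ (𝒯-rename⁺ ρ ts)

  𝒯-renameᵇ⁺ : ∀ {n m} (ρ : Fin n → Fin m) {M ū} →
               All (𝒯 M) ū → All (𝒯 (rename ρ M)) (renameB ρ ū)
  𝒯-renameᵇ⁺ ρ []         = []
  𝒯-renameᵇ⁺ ρ (tu ∷ tū)  = 𝒯-rename⁺ ρ tu ∷ 𝒯-renameᵇ⁺ ρ tū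

mutual
  𝒯-rename⁻ : ∀ {n m} (ρ : Fin n → Fin m) (M : Tm n) {s} →
              𝒯 (rename ρ M) s → ∃ λ s₀ → s ≡ renameR ρ s₀ × 𝒯 M s₀
  𝒯-rename⁻ ρ (var x) var = var x , refl , var
  𝒯-rename⁻ ρ (lam M) (lam ts) with 𝒯-rename⁻ (ext ρ) M ts
  ... | s₀ , refl , ts₀ = lam s₀ , refl , lam ts₀
  𝒯-rename⁻ ρ (app P Q) (app ts tū) with 𝒯-rename⁻ ρ P ts | 𝒯-renameᵇ⁻ ρ Q tū
  ... | s₀ , refl , ts₀ | ū₀ , refl , tū₀ = app s₀ ū₀ , refl , app ts₀ tū₀
  𝒯-rename⁻ ρ (P ⊕ Q) (l⊕ ts) with 𝒯-rename⁻ ρ P ts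
  ... | s₀ , refl , ts₀ = (s₀ ⊕•) , refl , l⊕ ts₀
  𝒯-rename⁻ ρ (P ⊕ Q) (r⊕ ts) with 𝒯-rename⁻ ρ Q ts
  ... | s₀ , refl , ts₀ = (•⊕ s₀) , refl , r⊕ ts₀

  𝒯-renameᵇ⁻ : ∀ {n m} (ρ : Fin n → Fin m) (M : Tm n) {ū} →
               All (𝒯 (rename ρ M)) ū → ∃ λ ū₀ → ū ≡ renameB ρ ū₀ × All (𝒯 M) ū₀
  𝒯-renameᵇ⁻ ρ M [] = [] , refl , []
  𝒯-renameᵇ⁻ ρ M (tu ∷ tū) with 𝒯-rename⁻ ρ M tu | 𝒯-renameᵇ⁻ ρ M tū
  ... | u₀ , refl , tu₀ | ū₀ , refl , tū₀ = u₀ ∷ ū₀ , refl , tu₀ ∷ tū₀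

IsSingleSubst : ∀ {n} → Fin (suc n) → Tm n → (Fin (suc n) → Tm n) → Set
IsSingleSubst i N σ = σ i ≡ N × (∀ j (i≢j : i ≢ j) → σ j ≡ var (punchOut i≢j))

single-isSingle : ∀ {n} (N : Tm n) → IsSingleSubst zero N (single N)
single-isSingle N = refl , others
  where
  others : ∀ j (0≢j : zero ≢ j) → single N j ≡ var (punchOut 0≢j)
  others zero    0≢0 = ⊥-elim (0≢0 refl)
  others (suc k) _   = refl

exts-isSingle : ∀ {n} {i : Fin (suc n)} {N σ} →
                IsSingleSubst i N σ → IsSingleSubst (suc i) (rename suc N) (exts σ)
exts-isSingle {i = i} {σ = σ} (σi≡N , σj≡var) = cong (rename suc) σi≡N , others
  where
  others : ∀ j (i+1≢j : suc i ≢ j) → exts σ j ≡ var (punchOut i+1≢j)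
  others zero    _      = refl
  others (suc k) i+1≢j =
    cong (rename suc) (trans (σj≡var k (λ i≡k → i+1≢j (cong suc i≡k)))
                             (cong var (punchOut-cong i refl)))

mutual
  𝒯-subst⁺ : ∀ {n} {i : Fin (suc n)} {N σ} → IsSingleSubst i N σ →
             (M : Tm (suc n)) → ∀ {s ū u} →
             𝒯 M s → All (𝒯 N) ū → u ∈ ∂ i s ū → 𝒯 (subst σ M) u
  𝒯-subst⁺ {i = i} (σi≡N , σj≡var) (var j) {ū = ū} var tū u∈
    with ∂-var⁻ i j ū u∈ | tū
  ... | inj₁ (refl , refl)        | tu ∷ [] rewrite σi≡N = tu
  ... | inj₂ (i≢j , refl , refl) | []      rewrite σj≡var j i≢j = var
  𝒯-subst⁺ σ-single (lam M) (lam ts) tū u∈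
    with u′ , u′∈ , refl ← ∈-map⁻ lam u∈ =
    lam (𝒯-subst⁺ (exts-isSingle σ-single) M ts (𝒯-renameᵇ⁺ suc tū) u′∈)
  𝒯-subst⁺ σ-single (app P Q) {app s t̄} {ū} (app ts tt) tū u∈
    with ū₁ , ū₂ , ∈splits , a , b , a∈ , b∈ , refl ← ∂-app⁻ _ s t̄ ū u∈ =
    let tū₁ , tū₂ = splits-All ū ∈splits tū
    in  app (𝒯-subst⁺ σ-single P ts tū₁ a∈) (𝒯-substᵇ⁺ σ-single Q tt tū₂ b∈)
  𝒯-subst⁺ σ-single (P ⊕ Q) (l⊕ ts) tū u∈
    with u′ , u′∈ , refl ← ∈-map⁻ _⊕• u∈ = l⊕ (𝒯-subst⁺ σ-single P ts tū u′∈)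
  𝒯-subst⁺ σ-single (P ⊕ Q) (r⊕ ts) tū u∈
    with u′ , u′∈ , refl ← ∈-map⁻ •⊕_ u∈ = r⊕ (𝒯-subst⁺ σ-single Q ts tū u′∈)

  𝒯-substᵇ⁺ : ∀ {n} {i : Fin (suc n)} {N σ} → IsSingleSubst i N σ →
              (Q : Tm (suc n)) → ∀ {t̄ ū v̄} →
              All (𝒯 Q) t̄ → All (𝒯 N) ū → v̄ ∈ ∂ᵇ i t̄ ū → All (𝒯 (subst σ Q)) v̄
  𝒯-substᵇ⁺ σ-single Q {ū = []}    []         []   (here refl) = []
  𝒯-substᵇ⁺ σ-single Q {t ∷ t̄} {ū} (tt ∷ tt̄) tū v̄∈
    with ū₁ , ū₂ , ∈splits , a , b , a∈ , b∈ , refl ← ∂ᵇ-cons⁻ _ t t̄ ū v̄∈ =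
    let tū₁ , tū₂ = splits-All ū ∈splits tū
    in  𝒯-subst⁺ σ-single Q tt tū₁ a∈ ∷ 𝒯-substᵇ⁺ σ-single Q tt̄ tū₂ b∈

mutual
  𝒯-subst⁻ : ∀ {n} {i : Fin (suc n)} {N σ} → IsSingleSubst i N σ →
             (M : Tm (suc n)) → ∀ {u} → 𝒯 (subst σ M) u →
             ∃₂ λ s ū → 𝒯 M s × All (𝒯 N) ū × u ∈ ∂ i s ū
  𝒯-subst⁻ {i = i} (σi≡N , σj≡var) (var j) {u} tu with i ≟ j
  ... | yes refl rewrite σi≡N = var i , u ∷ [] , var , tu ∷ [] , ∂-var-here i u
  ... | no i≢j rewrite σj≡var j i≢j with tu
  ...   | var = var j , [] , var , [] , ∂-var-other i≢j
  𝒯-subst⁻ {N = N} σ-single (lam M) (lam tu)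
    with s , ū′ , ts , tū′ , u∈ ← 𝒯-subst⁻ (exts-isSingle σ-single) M tu
    with ū , refl , tū ← 𝒯-renameᵇ⁻ suc N tū′ =
    lam s , ū , lam ts , tū , ∈-map⁺ lam u∈
  𝒯-subst⁻ σ-single (app P Q) (app tu tv̄)
    with s , ū₁ , ts , tū₁ , a∈ ← 𝒯-subst⁻ σ-single P tu
       | t̄ , ū₂ , tt̄ , tū₂ , b∈ ← 𝒯-substᵇ⁻ σ-single Q tv̄ =
    app s t̄ , ū₁ ++ ū₂ , app ts tt̄ , ++⁺ tū₁ tū₂ , ∂-app⁺ _ s t̄ ū₁ ū₂ a∈ b∈
  𝒯-subst⁻ σ-single (P ⊕ Q) (l⊕ tu)
    with s , ū , ts , tū , u∈ ← 𝒯-subst⁻ σ-single P tu =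
    (s ⊕•) , ū , l⊕ ts , tū , ∈-map⁺ _⊕• u∈
  𝒯-subst⁻ σ-single (P ⊕ Q) (r⊕ tu)
    with s , ū , ts , tū , u∈ ← 𝒯-subst⁻ σ-single Q tu =
    (•⊕ s) , ū , r⊕ ts , tū , ∈-map⁺ •⊕_ u∈

  𝒯-substᵇ⁻ : ∀ {n} {i : Fin (suc n)} {N σ} → IsSingleSubst i N σ →
              (Q : Tm (suc n)) → ∀ {v̄} → All (𝒯 (subst σ Q)) v̄ →
              ∃₂ λ t̄ ū → All (𝒯 Q) t̄ × All (𝒯 N) ū × v̄ ∈ ∂ᵇ i t̄ ū
  𝒯-substᵇ⁻ σ-single Q [] = [] , [] , [] , [] , here refl
  𝒯-substᵇ⁻ σ-single Q (tv ∷ tv̄)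
    with t , ū₁ , tt , tū₁ , a∈ ← 𝒯-subst⁻ σ-single Q tv
       | t̄ , ū₂ , tt̄ , tū₂ , b∈ ← 𝒯-substᵇ⁻ σ-single Q tv̄ =
    t ∷ t̄ , ū₁ ++ ū₂ , tt ∷ tt̄ , ++⁺ tū₁ tū₂ , ∂ᵇ-cons⁺ _ t t̄ ū₁ ū₂ a∈ b∈

headVar-agrees : ∀ {n} {M : Tm n} {s} → 𝒯 M s → varHeadR s ≡ varHeadTm M
headVar-agrees var          = refl
headVar-agrees (lam _)      = refl
headVar-agrees (app ts _)   = headVar-agrees ts
headVar-agrees (l⊕ _)       = refl
headVar-agrees (r⊕ _)       = refl

∈-Lrapp-headVar : ∀ {n} (s : Res n) (r̄ : Bag n) {t̄ a b̄} → varHeadR s ≡ true →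
                  a ∈ Lrapp s r̄ → b̄ ∈ Lb t̄ → app a b̄ ∈ Lrapp (app s r̄) t̄
∈-Lrapp-headVar s r̄ headVar a∈ b̄∈ rewrite headVar = ∈-product⁺ app a∈ b̄∈

∈-Lrapp-notHeadVar : ∀ {n} (s : Res n) (r̄ : Bag n) {t̄ a} → varHeadR s ≡ false →
                     a ∈ Lrapp s r̄ → app a t̄ ∈ Lrapp (app s r̄) t̄
∈-Lrapp-notHeadVar s r̄ {t̄} noHeadVar a∈ rewrite noHeadVar = ∈-map⁺ (λ r → app r t̄) a∈

mutual
  L-sound : ∀ {n} (M : Tm n) {s u} → 𝒯 M s → u ∈ Lr s → 𝒯 (Lt M) u
  L-sound (var x)         var               (here refl) = var
  L-sound (lam (M ⊕ N))   (lam (l⊕ ts))     (here refl) = l⊕ (lam ts)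
  L-sound (lam (M ⊕ N))   (lam (r⊕ ts))     (here refl) = r⊕ (lam ts)
  L-sound (lam (var x))   (lam var)         (here refl) = lam var
  L-sound (lam (lam M))   (lam (lam ts))    u∈
    with u′ , u′∈ , refl ← ∈-map⁻ lam u∈ = lam (L-sound (lam M) (lam ts) u′∈)
  L-sound (lam (app P Q)) (lam (app ts tt̄)) u∈
    with u′ , u′∈ , refl ← ∈-map⁻ lam u∈ = lam (L-sound (app P Q) (app ts tt̄) u′∈)
  L-sound (app P Q)       (app ts tt̄)      u∈ = L-soundApp P Q ts tt̄ u∈
  L-sound (M ⊕ N)         (l⊕ ts)           u∈
    with u′ , u′∈ , refl ← ∈-map⁻ _⊕• u∈ = l⊕ (L-sound M ts u′∈)
  L-sound (M ⊕ N)         (r⊕ ts)           u∈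
    with u′ , u′∈ , refl ← ∈-map⁻ •⊕_ u∈ = r⊕ (L-sound N ts u′∈)

  L-soundApp : ∀ {n} (P Q : Tm n) {s t̄ u} →
               𝒯 P s → All (𝒯 Q) t̄ → u ∈ Lrapp s t̄ → 𝒯 (Ltapp P Q) u
  L-soundApp (var x)   Q var tt̄ u∈
    with v̄ , v̄∈ , refl ← ∈-map⁻ (app (var x)) u∈ = app var (L-soundBag Q tt̄ v̄∈)
  L-soundApp (lam M)   Q (lam ts) tt̄ u∈ =
    𝒯-subst⁺ (single-isSingle Q) M ts tt̄ u∈
  L-soundApp (P₁ ⊕ P₂) Q (l⊕ ts) tt̄ (here refl) = l⊕ (app ts tt̄)
  L-soundApp (P₁ ⊕ P₂) Q (r⊕ ts) tt̄ (here refl) = r⊕ (app ts tt̄)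
  -- nested application: Ltapp and Lrapp branch on the same head bit
  L-soundApp (app M R) Q {app s r̄} {t̄} (app ts tr̄) tt̄ u∈
    with varHeadTm M | varHeadR s | headVar-agrees ts
  ... | true  | .true  | refl
    with a , b̄ , a∈ , b̄∈ , refl ← ∈-product⁻ app {Lrapp s r̄} u∈ =
    app (L-soundApp M R ts tr̄ a∈) (L-soundBag Q tt̄ b̄∈)
  ... | false | .false | refl
    with a , a∈ , refl ← ∈-map⁻ (λ r → app r t̄) u∈ =
    app (L-soundApp M R ts tr̄ a∈) tt̄

  L-soundBag : ∀ {n} (Q : Tm n) {t̄ v̄} → All (𝒯 Q) t̄ → v̄ ∈ Lb t̄ → All (𝒯 (Lt Q)) v̄
  L-soundBag Q [] (here refl) = []
  L-soundBag Q {t ∷ t̄} (tt ∷ tt̄) v̄∈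
    with a , b̄ , a∈ , b̄∈ , refl ← ∈-product⁻ _∷_ {Lr t} v̄∈ =
    L-sound Q tt a∈ ∷ L-soundBag Q tt̄ b̄∈

mutual
  L-complete : ∀ {n} (M : Tm n) → 𝒯 (Lt M) ⊆ LSet (𝒯 M)
  L-complete (var x)         var             = var x , var , here refl
  L-complete (lam (M ⊕ N))   (l⊕ (lam ts))   = lam (_ ⊕•) , lam (l⊕ ts) , here refl
  L-complete (lam (M ⊕ N))   (r⊕ (lam ts))   = lam (•⊕ _) , lam (r⊕ ts) , here refl
  L-complete (lam (var x))   (lam var)       = lam (var x) , lam var , here refl
  L-complete (lam (lam M))   (lam tu) with L-complete (lam M) tu
  ... | lam s , lam ts , u∈ = lam (lam s) , lam (lam ts) , ∈-map⁺ lam u∈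
  L-complete (lam (app P Q)) (lam tu) with L-complete (app P Q) tu
  ... | app s t̄ , app ts tt̄ , u∈ = lam (app s t̄) , lam (app ts tt̄) , ∈-map⁺ lam u∈
  L-complete (app P Q)       tu
    with s , t̄ , ts , tt̄ , u∈ ← L-completeApp P Q tu = app s t̄ , app ts tt̄ , u∈
  L-complete (M ⊕ N)         (l⊕ tu)
    with s , ts , u∈ ← L-complete M tu = (s ⊕•) , l⊕ ts , ∈-map⁺ _⊕• u∈
  L-complete (M ⊕ N)         (r⊕ tu)
    with s , ts , u∈ ← L-complete N tu = (•⊕ s) , r⊕ ts , ∈-map⁺ •⊕_ u∈

  L-completeApp : ∀ {n} (P Q : Tm n) {u} → 𝒯 (Ltapp P Q) u →
                  ∃₂ λ s t̄ → 𝒯 P s × All (𝒯 Q) t̄ × u ∈ Lrapp s t̄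
  L-completeApp (var x)   Q (app var tv̄)
    with t̄ , tt̄ , v̄∈ ← L-completeBag Q tv̄ =
    var x , t̄ , var , tt̄ , ∈-map⁺ (app (var x)) v̄∈
  L-completeApp (lam M)   Q tu
    with s , ū , ts , tū , u∈ ← 𝒯-subst⁻ (single-isSingle Q) M tu =
    lam s , ū , lam ts , tū , u∈
  L-completeApp (P₁ ⊕ P₂) Q (l⊕ (app ts tt̄)) = (_ ⊕•) , _ , l⊕ ts , tt̄ , here refl
  L-completeApp (P₁ ⊕ P₂) Q (r⊕ (app ts tt̄)) = (•⊕ _) , _ , r⊕ ts , tt̄ , here refl
  -- nested application: the branch taken by Ltapp is also taken by Lrapp
  L-completeApp (app M R) Q tu with varHeadTm M in headVar
  L-completeApp (app M R) Q (app tu tv̄) | true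
    with s , r̄ , ts , tr̄ , a∈ ← L-completeApp M R tu
       | t̄ , tt̄ , b̄∈ ← L-completeBag Q tv̄ =
    app s r̄ , t̄ , app ts tr̄ , tt̄ ,
    ∈-Lrapp-headVar s r̄ (trans (headVar-agrees ts) headVar) a∈ b̄∈
  L-completeApp (app M R) Q (app tu tt̄) | false
    with s , r̄ , ts , tr̄ , a∈ ← L-completeApp M R tu =
    app s r̄ , _ , app ts tr̄ , tt̄ ,
    ∈-Lrapp-notHeadVar s r̄ (trans (headVar-agrees ts) headVar) a∈

  L-completeBag : ∀ {n} (Q : Tm n) {v̄} → All (𝒯 (Lt Q)) v̄ →
                  ∃ λ t̄ → All (𝒯 Q) t̄ × v̄ ∈ Lb t̄
  L-completeBag Q [] = [] , [] , here refl
  L-completeBag Q (tv ∷ tv̄)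
    with t , tt , a∈ ← L-complete Q tv
       | t̄ , tt̄ , b̄∈ ← L-completeBag Q tv̄ =
    t ∷ t̄ , tt ∷ tt̄ , ∈-product⁺ _∷_ a∈ b̄∈

≡ₛ-antisym : ∀ {n} {E F : RSet n} → E ⊆ F → F ⊆ E → E ≡ₛ F
≡ₛ-antisym E⊆F F⊆E u =
  (λ (u′ , u≈u′ , Eu′) → u′ , u≈u′ , E⊆F Eu′) ,
  (λ (u′ , u≈u′ , Fu′) → u′ , u≈u′ , F⊆E Fu′)

lemma4p7 : ∀ {n : ℕ} (M : Tm n) → LSet (𝒯 M) ≡ₛ 𝒯 (Lt M)
lemma4p7 M = ≡ₛ-antisym (λ (s , ts , u∈) → L-sound M ts u∈) (L-complete M)
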